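{- Let $G$ be an abelian group with no elements of order $2$, and let $A,A',B$ be finite multisets with elements in $G$. If $A+\mathrm{FS}(B)=A'+\mathrm{FS}(B)$, then $A=A'$.
   Context: Multisets are counted with multiplicity. For a finite multiset $B=\{b_1,\dots,b_k\}$, $\mathrm{FS}(B)$ is the multiset of the $2^k$ sums $\sum_{i\in I}b_i$, $I\subseteq\{1,\dots,k\}$. For finite multisets $A,C$, $A+C$ denotes the multiset $\{a+c:(a,c)\in A\times C\}$, where each pair is counted with multiplicity $\mu_A(a)\mu_C(c)$. -}

module Defs where

open import Level using (Level)
open import Algebra.Bundles using (AbelianGroup)
open import Data.List using (List; []; _∷_; _++_; map; concatMap)
import Data.List.Relation.Binary.Permutation.Setoid as Perm

-- Finite multisets over the carrier of an abelian group G are represented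
-- by lists; multiset equality (with multiplicity) is permutation up to
-- the group's equality ≈.
module MultisetOps {c ℓ : Level} (G : AbelianGroup c ℓ) where
  open AbelianGroup G

  NoOrderTwo : Set (c Level.⊔ ℓ)
  NoOrderTwo = ∀ x → x ∙ x ≈ ε → x ≈ ε

  FS : List Carrier → List Carrier
  FS []      = ε ∷ []
  FS (b ∷ B) = FS B ++ map (b ∙_) (FS B)

  _⊕_ : List Carrier → List Carrier → List Carrier
  A ⊕ C = concatMap (λ a → map (a ∙_) C) A

  _≋ₘ_ : List Carrier → List Carrier → Set (c Level.⊔ ℓ)
  _≋ₘ_ = Perm._↭_ setoid

-- Since FS(b ∷ B) = FS B + {0, b}, induction on B reduces the claim to cancelling the factor
-- (1 + b) of the group semiring ℕ[G]: (1 + b)A = (1 + b)A' implies A = A'.  From that equation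
-- one gets (1 + bⁿ)A = (1 + bⁿ)A' for every odd n, so every a ∈ A lies in A' or in bⁿA'.  If
-- the latter happens for |A'| + 1 odd exponents n, the pigeonhole principle gives b²ᵈ = 1 with
-- d > 0; as G has no element of order 2, b then has some odd order o, and (1 + bᵒ)A = (1 + bᵒ)A'
-- reads 2A = 2A', which again puts a in A'.  Removing a and b + a from both sides, induct on A.
-- Memberships are read off the permutations themselves, so no decidable equality on G is needed.
module Submission where

open import Defs
open import Level using (Level)
open import Algebra.Bundles using (AbelianGroup)
open import Data.List using (List; []; _∷_; _++_; map; concat; length; lookup)
import Data.List.Properties as List
open import Data.List.Relation.Unary.Any as Any using (Any; here)
open import Data.List.Relation.Unary.Any.Properties using (++⁻; map⁻; lookup-index)
open import Data.List.Membership.Setoid.Properties using (∈-∃++)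
import Data.List.Relation.Binary.Permutation.Setoid as Permutation
import Data.List.Relation.Binary.Permutation.Setoid.Properties as PermutationProperties
open import Data.Fin using (Fin; zero; suc; toℕ)
open import Data.Fin.Properties using (pigeonhole)
open import Data.Nat using (ℕ; zero; suc; _+_; _<_; s≤s)
open import Data.Nat.Properties using (+-suc; m≤m+n; n<1+n; m≤n⇒∃[o]m+o≡n)
open import Data.Nat.Induction using (<-rec)
open import Data.Nat.Tactic.RingSolver using (solve-∀)
open import Data.Product using (∃-syntax; _,_)
open import Data.Sum using (_⊎_; inj₁; inj₂; [_,_]′)
import Data.Sum as Sum
open import Function using (_∘_; id)
open import Relation.Binary.PropositionalEquality as ≡ using (_≡_)

data Parity : ℕ → Set where
  even : ∀ m → Parity (m + m)
  odd  : ∀ m → Parity (suc (m + m))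

parity : ∀ n → Parity n
parity zero = even 0
parity (suc n) with parity n
... | even m = odd m
... | odd m  = ≡.subst Parity (≡.cong suc (+-suc m m)) (even (suc m))

∀-⊎⇒⊎-∀ : ∀ {p q n} {P : Set p} {Q : Fin n → Set q} →
          (∀ i → P ⊎ Q i) → P ⊎ (∀ i → Q i)
∀-⊎⇒⊎-∀ {n = zero}  f = inj₂ λ ()
∀-⊎⇒⊎-∀ {n = suc n} f with f zero | ∀-⊎⇒⊎-∀ (f ∘ suc)
... | inj₁ p | _       = inj₁ p
... | inj₂ _ | inj₁ p  = inj₁ p
... | inj₂ q | inj₂ qs = inj₂ λ { zero → q ; (suc i) → qs i }

module _ {c ℓ : Level} (G : AbelianGroup c ℓ) where
  open AbelianGroup G
  open MultisetOps G
  open Permutation setoid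
    using ( _↭_; prep; ↭-refl; ↭-sym; ↭-trans; ↭-prep; ↭-reflexive; ↭-transˡ-≋
          ; module PermutationReasoning)
  open PermutationProperties setoid
    using ( shift; ↭-shift; ++⁺; ++⁺ˡ; zoom; map⁺; ++-commutativeMonoid; dropMiddle; drop-∷
          ; ∈-resp-↭; xs↭ys⇒|xs|≡|ys|)
  open import Data.List.Membership.Setoid setoid using (_∈_)
  open import Algebra.Properties.Group group using (∙-cancelʳ; identityʳ-unique)
  open import Algebra.Properties.Monoid.Mult monoid using (_×_; ×-congˡ; ×-homo-+)

  infixr 4 _⟫_
  _⟫_ : ∀ {xs ys zs} → xs ↭ ys → ys ↭ zs → xs ↭ zs
  _⟫_ = ↭-trans

  ∈⇒↭∷ : ∀ {x xs} → x ∈ xs → ∃[ ys ] xs ↭ x ∷ ys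
  ∈⇒↭∷ x∈xs with ys , zs , _ , x≈w , eq ← ∈-∃++ setoid x∈xs =
    ys ++ zs , ↭-transˡ-≋ eq (shift (sym x≈w) ys zs)

  ×-repeat⇒ε : ∀ g m d → m × g ≈ (m + d) × g → d × g ≈ ε
  ×-repeat⇒ε g m d h = identityʳ-unique (m × g) (d × g) (sym (trans h (×-homo-+ g m d)))

  ×-halve : NoOrderTwo → ∀ g n → (n + n) × g ≈ ε → n × g ≈ ε
  ×-halve no2 g n h = no2 (n × g) (trans (sym (×-homo-+ g n n)) h)

  odd-order : NoOrderTwo → ∀ g n → (suc n + suc n) × g ≈ ε → ∃[ k ] suc (k + k) × g ≈ ε
  odd-order no2 g = <-rec _ step
    where
    step : ∀ n → (∀ {m} → m < n → (suc m + suc m) × g ≈ ε → ∃[ k ] suc (k + k) × g ≈ ε) →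
           (suc n + suc n) × g ≈ ε → ∃[ k ] suc (k + k) × g ≈ ε
    step n rec h with parity n | ×-halve no2 g (suc n) h
    ... | even m | g¹⁺²ᵐ≈ε = m , g¹⁺²ᵐ≈ε
    ... | odd m  | g²⁺²ᵐ≈ε =
      rec (s≤s (m≤m+n m m)) (trans (×-congˡ (≡.cong suc (+-suc m m))) g²⁺²ᵐ≈ε)

  translate : Carrier → List Carrier → List Carrier
  translate g = map (g ∙_)

  translate⁺ : ∀ g {X Y} → X ↭ Y → translate g X ↭ translate g Y
  translate⁺ g = map⁺ setoid ∙-congˡ

  translate-resp : ∀ {g h} → g ≈ h → ∀ X → translate g X ↭ translate h X
  translate-resp g≈h []      = ↭-refl
  translate-resp g≈h (x ∷ X) = prep (∙-congʳ g≈h) (translate-resp g≈h X)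

  translate-∙ : ∀ g h X → translate g (translate h X) ↭ translate (g ∙ h) X
  translate-∙ g h []      = ↭-refl
  translate-∙ g h (x ∷ X) = prep (sym (assoc g h x)) (translate-∙ g h X)

  1+[_]_ : Carrier → List Carrier → List Carrier
  1+[ g ] X = X ++ translate g X

  1+-resp : ∀ {g h} → g ≈ h → ∀ X → 1+[ g ] X ↭ 1+[ h ] X
  1+-resp g≈h X = ++⁺ˡ X (translate-resp g≈h X)

  1+-∷ : ∀ g x X → 1+[ g ] (x ∷ X) ↭ x ∷ g ∙ x ∷ 1+[ g ] X
  1+-∷ g x X = ↭-prep x (↭-shift X (translate g X))

  1+⁺ : ∀ g {X Y} → X ↭ Y → 1+[ g ] X ↭ 1+[ g ] Y
  1+⁺ g X↭Y = ++⁺ X↭Y (translate⁺ g X↭Y)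

  ∈-1+⁻ : ∀ {g x X} → x ∈ 1+[ g ] X → x ∈ X ⊎ Any (λ y → x ≈ g ∙ y) X
  ∈-1+⁻ {X = X} = Sum.map₂ map⁻ ∘ ++⁻ X

  ∈-1+ε⁻ : ∀ {g x X} → g ≈ ε → x ∈ 1+[ g ] X → x ∈ X
  ∈-1+ε⁻ g≈ε = [ id , Any.map (λ x≈gy → trans x≈gy (trans (∙-congʳ g≈ε) (identityˡ _))) ]′ ∘ ∈-1+⁻

  1+-expand : ∀ b g X →
              X ++ translate g (1+[ b ] X) ++ translate (b ∙ (b ∙ g)) X ↭
              1+[ g ] X ++ translate (g ∙ b) (1+[ b ] X)
  1+-expand b g X = begin
    X ++ translate g (1+[ b ] X) ++ translate (b ∙ (b ∙ g)) X
      ≡⟨ ≡.cong (λ T → X ++ T ++ translate (b ∙ (b ∙ g)) X)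
                (List.map-++ (g ∙_) X (translate b X)) ⟩
    X ++ (translate g X ++ translate g (translate b X)) ++ translate (b ∙ (b ∙ g)) X
      ≡⟨ ≡.cong (X ++_) (List.++-assoc (translate g X) _ _) ⟩
    X ++ translate g X ++ translate g (translate b X) ++ translate (b ∙ (b ∙ g)) X
      ↭⟨ ++⁺ˡ X (++⁺ˡ (translate g X) (++⁺ (translate-∙ g b X) bbg≈gbb)) ⟩
    X ++ translate g X ++ translate (g ∙ b) X ++ translate (g ∙ b) (translate b X)
      ≡⟨ List.++-assoc X (translate g X) _ ⟨
    1+[ g ] X ++ translate (g ∙ b) X ++ translate (g ∙ b) (translate b X)
      ≡⟨ ≡.cong (1+[ g ] X ++_) (List.map-++ ((g ∙ b) ∙_) X (translate b X)) ⟨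
    1+[ g ] X ++ translate (g ∙ b) (1+[ b ] X) ∎
    where
    open PermutationReasoning
    bbg≈gbb : translate (b ∙ (b ∙ g)) X ↭ translate (g ∙ b) (translate b X)
    bbg≈gbb = ↭-sym (translate-∙ (g ∙ b) b X ⟫
      translate-resp (trans (assoc g b b) (trans (comm g (b ∙ b)) (assoc b b g))) X)

  -- (1 + b²g) = (1 + g) + gb(1 + b) − g(1 + b) in the group ring, and g(1 + b) cancels.
  1+-step : ∀ b g A A' → 1+[ b ] A ↭ 1+[ b ] A' → 1+[ g ] A ↭ 1+[ g ] A' →
            1+[ b ∙ (b ∙ g) ] A ↭ 1+[ b ∙ (b ∙ g) ] A'
  1+-step b g A A' hb hg = dropMiddle A A' (begin
    A ++ translate g (1+[ b ] A') ++ translate (b ∙ (b ∙ g)) A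
      ↭⟨ zoom A (translate⁺ g (↭-sym hb)) ⟩
    A ++ translate g (1+[ b ] A) ++ translate (b ∙ (b ∙ g)) A
      ↭⟨ 1+-expand b g A ⟩
    1+[ g ] A ++ translate (g ∙ b) (1+[ b ] A)
      ↭⟨ ++⁺ hg (translate⁺ (g ∙ b) hb) ⟩
    1+[ g ] A' ++ translate (g ∙ b) (1+[ b ] A')
      ↭⟨ 1+-expand b g A' ⟨
    A' ++ translate g (1+[ b ] A') ++ translate (b ∙ (b ∙ g)) A' ∎)
    where open PermutationReasoning

  1+-oddPower : ∀ b A A' → 1+[ b ] A ↭ 1+[ b ] A' →
           ∀ k → 1+[ suc (k + k) × b ] A ↭ 1+[ suc (k + k) × b ] A'
  1+-oddPower b A A' hb zero = 1+-resp (identityʳ b) A ⟫ hb ⟫ 1+-resp (sym (identityʳ b)) A'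
  1+-oddPower b A A' hb (suc k) =
    1+-resp bᵏ⁺² A
    ⟫ 1+-step b (suc (k + k) × b) A A' hb (1+-oddPower b A A' hb k)
    ⟫ 1+-resp (sym bᵏ⁺²) A'
    where
    bᵏ⁺² : suc (suc k + suc k) × b ≈ b ∙ (b ∙ suc (k + k) × b)
    bᵏ⁺² = ∙-congˡ (∙-congˡ (×-congˡ (+-suc k k)))

  -- Pigeonhole: two of the |X| + 1 odd exponents hit the same y ∈ X.
  odd-translates⇒odd-order : NoOrderTwo → ∀ b {a} X →
    (∀ (i : Fin (suc (length X))) → Any (λ y → a ≈ suc (toℕ i + toℕ i) × b ∙ y) X) →
    ∃[ k ] suc (k + k) × b ≈ ε
  odd-translates⇒odd-order no2 b {a} X a∈ₖ
    with i , j , i<j , same ← pigeonhole (n<1+n _) (Any.index ∘ a∈ₖ)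
    with o , i+o≡j ← m≤n⇒∃[o]m+o≡n i<j
    = odd-order no2 b o (×-repeat⇒ε b (suc (toℕ i + toℕ i)) (suc o + suc o) bⁱ≈bʲ)
    where
    y = lookup X (Any.index (a∈ₖ i))
    a≈bʲy : a ≈ suc (toℕ j + toℕ j) × b ∙ y
    a≈bʲy = ≡.subst (λ p → a ≈ _ ∙ lookup X p) (≡.sym same) (lookup-index (a∈ₖ j))
    odd-+ : ∀ m o → suc ((suc m + o) + (suc m + o)) ≡ suc (m + m) + (suc o + suc o)
    odd-+ = solve-∀
    bⁱ≈bʲ : suc (toℕ i + toℕ i) × b ≈ (suc (toℕ i + toℕ i) + (suc o + suc o)) × b
    bⁱ≈bʲ = trans (∙-cancelʳ y _ _ (trans (sym (lookup-index (a∈ₖ i))) a≈bʲy))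
                  (×-congˡ (≡.trans (≡.cong (λ m → suc (m + m)) (≡.sym i+o≡j)) (odd-+ (toℕ i) o)))

  1+-head∈ : NoOrderTwo → ∀ b a A A' → 1+[ b ] (a ∷ A) ↭ 1+[ b ] A' → a ∈ A'
  1+-head∈ no2 b a A A' h = [ id , odd-case ]′ (∀-⊎⇒⊎-∀ (∈-1+⁻ ∘ a∈ ∘ toℕ))
    where
    a∈ : ∀ k → a ∈ 1+[ suc (k + k) × b ] A'
    a∈ k = ∈-resp-↭ (1+-oddPower b (a ∷ A) A' h k) (here refl)
    odd-case : (∀ i → Any (λ y → a ≈ suc (toℕ i + toℕ i) × b ∙ y) A') → a ∈ A'
    odd-case a∈ₖ with k , bᵏ≈ε ← odd-translates⇒odd-order no2 b A' a∈ₖ = ∈-1+ε⁻ bᵏ≈ε (a∈ k)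

  1+-cancel : NoOrderTwo → ∀ b A A' → 1+[ b ] A ↭ 1+[ b ] A' → A ↭ A'
  1+-cancel no2 b []      []      h = ↭-refl
  1+-cancel no2 b []      (_ ∷ _) h with () ← xs↭ys⇒|xs|≡|ys| h
  1+-cancel no2 b (a ∷ A) A'      h =
    let A'₀ , A'↭a∷A'₀ = ∈⇒↭∷ (1+-head∈ no2 b a A A' h)
        h′ : a ∷ b ∙ a ∷ 1+[ b ] A ↭ a ∷ b ∙ a ∷ 1+[ b ] A'₀
        h′ = ↭-sym (1+-∷ b a A) ⟫ h ⟫ 1+⁺ b A'↭a∷A'₀ ⟫ 1+-∷ b a A'₀
    in ↭-prep a (1+-cancel no2 b A A'₀ (drop-∷ (drop-∷ h′))) ⟫ ↭-sym A'↭a∷A'₀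

  ⊕-identityʳ : ∀ X → X ⊕ (ε ∷ []) ↭ X
  ⊕-identityʳ []      = ↭-refl
  ⊕-identityʳ (x ∷ X) = prep (identityʳ x) (⊕-identityʳ X)

  ⊕-distribʳ-++ : ∀ X Y Z → (X ++ Y) ⊕ Z ≡ X ⊕ Z ++ Y ⊕ Z
  ⊕-distribʳ-++ X Y Z =
    ≡.trans (≡.cong concat (List.map-++ translate-Z X Y))
            (≡.sym (List.concat-++ (map translate-Z X) (map translate-Z Y)))
    where
    translate-Z : Carrier → List Carrier
    translate-Z x = translate x Z

  ⊕-distribˡ-++ : ∀ X Y Z → X ⊕ (Y ++ Z) ↭ X ⊕ Y ++ X ⊕ Z
  ⊕-distribˡ-++ []      Y Z = ↭-refl
  ⊕-distribˡ-++ (x ∷ X) Y Z = begin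
    translate x (Y ++ Z) ++ X ⊕ (Y ++ Z)
      ≡⟨ ≡.cong (_++ X ⊕ (Y ++ Z)) (List.map-++ (x ∙_) Y Z) ⟩
    (translate x Y ++ translate x Z) ++ X ⊕ (Y ++ Z)
      ↭⟨ ++⁺ˡ (translate x Y ++ translate x Z) (⊕-distribˡ-++ X Y Z) ⟩
    (translate x Y ++ translate x Z) ++ (X ⊕ Y ++ X ⊕ Z)
      ↭⟨ ++-interchange (translate x Y) (translate x Z) (X ⊕ Y) (X ⊕ Z) ⟩
    (translate x Y ++ X ⊕ Y) ++ (translate x Z ++ X ⊕ Z) ∎
    where
    open PermutationReasoning
    open import Algebra.Solver.CommutativeMonoid ++-commutativeMonoid
      using (solve; _⊜_) renaming (_⊕_ to _∪_)
    ++-interchange : ∀ P Q R S → (P ++ Q) ++ (R ++ S) ↭ (P ++ R) ++ (Q ++ S)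
    ++-interchange = solve 4 (λ P Q R S → (P ∪ Q) ∪ (R ∪ S) ⊜ (P ∪ R) ∪ (Q ∪ S)) ↭-refl

  ⊕-translate : ∀ g X Y → X ⊕ translate g Y ↭ translate g X ⊕ Y
  ⊕-translate g []      Y = ↭-refl
  ⊕-translate g (x ∷ X) Y =
    ++⁺ (translate-∙ x g Y ⟫ translate-resp (comm x g) Y) (⊕-translate g X Y)

  ⊕-1+ : ∀ g X Y → X ⊕ (1+[ g ] Y) ↭ (1+[ g ] X) ⊕ Y
  ⊕-1+ g X Y = ⊕-distribˡ-++ X Y (translate g Y)
             ⟫ ++⁺ˡ (X ⊕ Y) (⊕-translate g X Y)
             ⟫ ↭-reflexive (≡.sym (⊕-distribʳ-++ X (translate g X) Y))

  ⊕-FS-cancelʳ : NoOrderTwo → ∀ B {A A'} → A ⊕ FS B ↭ A' ⊕ FS B → A ↭ A'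
  ⊕-FS-cancelʳ no2 []      {A} {A'} h = ↭-sym (⊕-identityʳ A) ⟫ h ⟫ ⊕-identityʳ A'
  ⊕-FS-cancelʳ no2 (b ∷ B) {A} {A'} h =
    1+-cancel no2 b A A' (⊕-FS-cancelʳ no2 B (↭-sym (⊕-1+ b A (FS B)) ⟫ h ⟫ ⊕-1+ b A' (FS B)))

lemma6p1 : {c ℓ : Level} (G : AbelianGroup c ℓ) →
    let open AbelianGroup G using (Carrier) in
    let open MultisetOps G in
    NoOrderTwo → (A A' B : List Carrier) →
    (A ⊕ FS B) ≋ₘ (A' ⊕ FS B) → A ≋ₘ A'
lemma6p1 G no2 A A' B = ⊕-FS-cancelʳ G no2 B
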